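{- For every algebraic signature $\Sigma$, the category $\mathbf{EqTG}_\Sigma$ has all pushouts along arrows of $\mathcal T$, and these are created by the inclusion functor $J_\Sigma\colon\mathbf{EqTG}_\Sigma\to\mathbf{EqHyp}_\Sigma$.
   Context: For a set $X$, $X^\star$ is the set of finite words over $X$, $f^\star$ acts letterwise, $\{*\}^\star\cong\mathbb N$ via length. A hypergraph is $(E,V,s,t)$ with $s,t\colon E\to V^\star$; morphisms $(h,k)$ with $k^\star\circ s=s'\circ h$, $k^\star\circ t=t'\circ h$ (category $\mathbf{Hyp}$). A hypergraph with equivalence is $(E,V,Q,s,t,q)$ with $(E,V,s,t)$ a hypergraph and $q\colon V\to Q$ surjective; morphisms are triples $(h_E,h_V,h_Q)$ with $(h_E,h_V)$ a hypergraph morphism and $h_Q\circ q=q'\circ h_V$ (category $\mathbf{EqHyp}$); $T\colon\mathbf{EqHyp}\to\mathbf{Hyp}$ forgets $Q,q$. $\mathsf{Pb}$: morphisms $(h_E,h_V,h_Q)\colon\mathcal G\to\mathcal H$ of $\mathbf{EqHyp}$ that are regular monos in $\mathbf{EqHyp}$ with $q_{\mathcal H}\circ h_V=h_Q\circ q_{\mathcal G}$ a pullback square in $\mathbf{Set}$. Signature $\Sigma=(O_\Sigma,\mathsf{ar}_\Sigma\colon O_\Sigma\to\mathbb N)$; $\mathcal G^\Sigma=(O_\Sigma,\{*\},\mathsf{ar}_\Sigma,\gamma_1)$, $\gamma_1$ sending each operation to the word of length 1. $\mathbf{TG}_\Sigma$ is the full subcategory of the slice $\mathbf{Hyp}/\mathcal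 G^\Sigma$ on those $l\colon\mathcal H\to\mathcal G^\Sigma$ with $t_{\mathcal H}$ injective. $\mathbf{EqHyp}_\Sigma$: objects $(\mathcal H,l)$, $\mathcal H\in\mathbf{EqHyp}$, $l\colon T(\mathcal H)\to\mathcal G^\Sigma$ in $\mathbf{Hyp}$; morphisms are $\mathbf{EqHyp}$-morphisms $h$ with $l=l'\circ T(h)$. $\mathbf{EqTG}_\Sigma$: full subcategory of $\mathbf{EqHyp}_\Sigma$ on $(\mathcal H,l)$ with $l\in\mathbf{TG}_\Sigma$; $S_\Sigma\colon\mathbf{EqTG}_\Sigma\to\mathbf{TG}_\Sigma$, $(\mathcal H,l)\mapsto l$, $h\mapsto T(h)$. $\mathcal T$ is the class of morphisms $h$ of $\mathbf{EqTG}_\Sigma$ such that $h\in\mathsf{Pb}$ (as an $\mathbf{EqHyp}$-morphism) and $S_\Sigma(h)$ is a regular monomorphism of $\mathbf{TG}_\Sigma$. -}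

module Defs where

open import Level using (0ℓ)
open import Data.Nat using (ℕ)
open import Data.Unit using (⊤; tt)
open import Data.List using (List; []; _∷_; map; replicate; [_])
open import Data.Product using (Σ; ∃; _×_; _,_; proj₁; proj₂)
open import Relation.Binary.Bundles using (Setoid)
open import Relation.Binary.PropositionalEquality as ≡ using (_≡_; refl)
open import Function.Bundles using (Func)
import Data.List.Relation.Binary.Pointwise as PW

-- Sets are modelled as setoids (no quotient types in Agda); maps as
-- setoid morphisms; equality of maps is pointwise.

Setoid₀ : Set₁
Setoid₀ = Setoid 0ℓ 0ℓ

∣_∣ : Setoid₀ → Set
∣ S ∣ = Setoid.Carrier S

Eq : (S : Setoid₀) → ∣ S ∣ → ∣ S ∣ → Set
Eq S = Setoid._≈_ S

Map : Setoid₀ → Setoid₀ → Set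
Map A B = Func A B

ap : {A B : Setoid₀} → Map A B → ∣ A ∣ → ∣ B ∣
ap f = Func.to f

_≐_ : {A B : Setoid₀} → Map A B → Map A B → Set
_≐_ {A} {B} f g = ∀ x → Eq B (ap f x) (ap g x)

idM : {A : Setoid₀} → Map A A
idM = record { to = λ x → x ; cong = λ p → p }

_∘M_ : {A B C : Setoid₀} → Map B C → Map A B → Map A C
g ∘M f = record { to = λ x → ap g (ap f x) ; cong = λ p → Func.cong g (Func.cong f p) }

Surjective : {A B : Setoid₀} → Map A B → Set
Surjective {A} {B} f = ∀ y → ∃ λ x → Eq B (ap f x) y

Injective : {A B : Setoid₀} → Map A B → Set
Injective {A} {B} f = ∀ x y → Eq B (ap f x) (ap f y) → Eq A x y

IsPullbackSq : {A B C D : Setoid₀} →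
  Map A B → Map A C → Map B D → Map C D → Set₁
IsPullbackSq {A} {B} {C} {D} f g h k =
  ((h ∘M f) ≐ (k ∘M g)) ×
  (∀ (X : Setoid₀) (a : Map X B) (b : Map X C) → (h ∘M a) ≐ (k ∘M b) →
     Σ (Map X A) λ u → ((f ∘M u) ≐ a) × ((g ∘M u) ≐ b) ×
       (∀ (v : Map X A) → (f ∘M v) ≐ a → (g ∘M v) ≐ b → v ≐ u))

-- Words: X^⋆ as lists with pointwise equality; f^⋆ letterwise.

Words : Setoid₀ → Setoid₀
Words A = PW.setoid A

star : {A B : Setoid₀} → Map A B → Map (Words A) (Words B)
star {A} {B} f = record { to = map (ap f) ; cong = go }
  where
  go : ∀ {xs ys} → PW.Pointwise (Eq A) xs ys →
       PW.Pointwise (Eq B) (map (ap f) xs) (map (ap f) ys)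
  go PW.[] = PW.[]
  go (p PW.∷ ps) = Func.cong f p PW.∷ go ps

star-id : {A : Setoid₀} (w : ∣ Words A ∣) → Eq (Words A) (ap (star (idM {A})) w) w
star-id {A} [] = PW.[]
star-id {A} (x ∷ w) = Setoid.refl A PW.∷ star-id {A} w

star-∘ : {A B C : Setoid₀} (g : Map B C) (f : Map A B) (w : ∣ Words A ∣) →
  Eq (Words C) (ap (star (g ∘M f)) w) (ap (star g) (ap (star f) w))
star-∘ {C = C} g f [] = PW.[]
star-∘ {C = C} g f (x ∷ w) = Setoid.refl C PW.∷ star-∘ g f w

-- A minimal notion of category (only the data needed to state
-- universal properties; equality of morphisms is a given relation).

record Cat : Set₂ where
  field
    Obj : Set₁
    Hom : Obj → Obj → Set
    _≈_ : ∀ {A B} → Hom A B → Hom A B → Set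
    _∘_ : ∀ {A B C} → Hom B C → Hom A B → Hom A C
    id  : ∀ {A} → Hom A A

module _ (𝒞 : Cat) where
  open Cat 𝒞

  IsPushout : ∀ {A B C} (f : Hom A B) (g : Hom A C)
    (P : Obj) (i₁ : Hom B P) (i₂ : Hom C P) → Set₁
  IsPushout {A} {B} {C} f g P i₁ i₂ =
    ((i₁ ∘ f) ≈ (i₂ ∘ g)) ×
    (∀ (X : Obj) (j₁ : Hom B X) (j₂ : Hom C X) → (j₁ ∘ f) ≈ (j₂ ∘ g) →
       Σ (Hom P X) λ u → ((u ∘ i₁) ≈ j₁) × ((u ∘ i₂) ≈ j₂) ×
         (∀ (v : Hom P X) → (v ∘ i₁) ≈ j₁ → (v ∘ i₂) ≈ j₂ → v ≈ u))

  HasPushout : ∀ {A B C} (f : Hom A B) (g : Hom A C) → Set₁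
  HasPushout {A} {B} {C} f g =
    Σ Obj λ P → Σ (Hom B P) λ i₁ → Σ (Hom C P) λ i₂ → IsPushout f g P i₁ i₂

  IsRegularMono : ∀ {A B} (h : Hom A B) → Set₁
  IsRegularMono {A} {B} h =
    Σ Obj λ K → Σ (Hom B K) λ f → Σ (Hom B K) λ g →
      ((f ∘ h) ≈ (g ∘ h)) ×
      (∀ (X : Obj) (k : Hom X B) → (f ∘ k) ≈ (g ∘ k) →
         Σ (Hom X A) λ u → ((h ∘ u) ≈ k) ×
           (∀ (v : Hom X A) → (h ∘ v) ≈ k → v ≈ u))

record Hyp : Set₁ where
  field
    E V : Setoid₀
    s t : Map E (Words V)

record HypHom (G H : Hyp) : Set where
  private
    module G = Hyp G
    module H = Hyp H
  field
    hE : Map G.E H.E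
    hV : Map G.V H.V
    s-comm : ((star hV) ∘M G.s) ≐ (H.s ∘M hE)
    t-comm : ((star hV) ∘M G.t) ≐ (H.t ∘M hE)

_≈Hyp_ : {G H : Hyp} → HypHom G H → HypHom G H → Set
h ≈Hyp k = (HypHom.hE h ≐ HypHom.hE k) × (HypHom.hV h ≐ HypHom.hV k)

idHyp : {G : Hyp} → HypHom G G
idHyp {G} = record
  { hE = idM ; hV = idM
  ; s-comm = λ e → star-id {Hyp.V G} (ap (Hyp.s G) e)
  ; t-comm = λ e → star-id {Hyp.V G} (ap (Hyp.t G) e) }

_∘Hyp_ : {G H K : Hyp} → HypHom H K → HypHom G H → HypHom G K
_∘Hyp_ {G} {H} {K} k h = record
  { hE = HypHom.hE k ∘M HypHom.hE h
  ; hV = HypHom.hV k ∘M HypHom.hV h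
  ; s-comm = λ e → W.trans (star-∘ kV hV (ap (Hyp.s G) e))
      (W.trans (Func.cong (star kV) (HypHom.s-comm h e))
               (HypHom.s-comm k (ap (HypHom.hE h) e)))
  ; t-comm = λ e → W.trans (star-∘ kV hV (ap (Hyp.t G) e))
      (W.trans (Func.cong (star kV) (HypHom.t-comm h e))
               (HypHom.t-comm k (ap (HypHom.hE h) e)))
  }
  where
  module W = Setoid (Words (Hyp.V K))
  kV = HypHom.hV k
  hV = HypHom.hV h

record EqHyp : Set₁ where
  field
    H : Hyp
    Q : Setoid₀
    q : Map (Hyp.V H) Q
    q-surj : Surjective q

record EqHypHom (G G' : EqHyp) : Set where
  private
    module G = EqHyp G
    module G' = EqHyp G'
  field
    T-hom : HypHom G.H G'.H
    hQ : Map G.Q G'.Q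
    q-comm : (hQ ∘M G.q) ≐ (G'.q ∘M HypHom.hV T-hom)

open EqHypHom public using (T-hom)

_≈EqHyp_ : {G G' : EqHyp} → EqHypHom G G' → EqHypHom G G' → Set
h ≈EqHyp k = (T-hom h ≈Hyp T-hom k) × (EqHypHom.hQ h ≐ EqHypHom.hQ k)

idEqHyp : {G : EqHyp} → EqHypHom G G
idEqHyp {G} = record { T-hom = idHyp ; hQ = idM
  ; q-comm = λ x → Setoid.refl (EqHyp.Q G) }

_∘EqHyp_ : {G H K : EqHyp} → EqHypHom H K → EqHypHom G H → EqHypHom G K
_∘EqHyp_ {G} {H} {K} k h = record
  { T-hom = T-hom k ∘Hyp T-hom h
  ; hQ = EqHypHom.hQ k ∘M EqHypHom.hQ h
  ; q-comm = λ x → Setoid.trans (EqHyp.Q K)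
      (Func.cong (EqHypHom.hQ k) (EqHypHom.q-comm h x))
      (EqHypHom.q-comm k (ap (HypHom.hV (T-hom h)) x))
  }

EqHypCat : Cat
EqHypCat = record { Obj = EqHyp ; Hom = EqHypHom ; _≈_ = _≈EqHyp_
  ; _∘_ = _∘EqHyp_ ; id = idEqHyp }

InPb : {G H : EqHyp} → EqHypHom G H → Set₁
InPb {G} {H} h =
  IsRegularMono EqHypCat h ×
  IsPullbackSq (HypHom.hV (T-hom h)) (EqHyp.q G) (EqHyp.q H) (EqHypHom.hQ h)

record Signature : Set₁ where
  field
    O  : Set
    ar : O → ℕ

HypΣ : Signature → Hyp
HypΣ Σ' = record
  { E = ≡.setoid O ; V = ≡.setoid ⊤
  ; s = record { to = λ o → replicate (ar o) tt
               ; cong = λ { refl → Setoid.refl (Words (≡.setoid ⊤)) } }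
  ; t = record { to = λ o → [ tt ]
               ; cong = λ { refl → Setoid.refl (Words (≡.setoid ⊤)) } }
  }
  where open Signature Σ'

module _ (Σ' : Signature) where

  SliceComm : {G H : Hyp} → HypHom G (HypΣ Σ') → HypHom H (HypΣ Σ') →
    HypHom G H → Set
  SliceComm l l' h = l ≈Hyp (l' ∘Hyp h)

  record TGObj : Set₁ where
    field
      H : Hyp
      l : HypHom H (HypΣ Σ')
      t-inj : Injective (Hyp.t H)

  record TGHom (A B : TGObj) : Set where
    field
      h : HypHom (TGObj.H A) (TGObj.H B)
      l-comm : SliceComm (TGObj.l A) (TGObj.l B) h

  TGCat : Cat
  TGCat = record
    { Obj = TGObj ; Hom = TGHom
    ; _≈_ = λ f g → TGHom.h f ≈Hyp TGHom.h g
    ; _∘_ = λ {A} {B} {C} g f → record { h = TGHom.h g ∘Hyp TGHom.h f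
        ; l-comm = (λ e → ≡.trans (proj₁ (TGHom.l-comm f) e)
                                  (proj₁ (TGHom.l-comm g) (ap (HypHom.hE (TGHom.h f)) e)))
                 , (λ v → ≡.trans (proj₂ (TGHom.l-comm f) v)
                                  (proj₂ (TGHom.l-comm g) (ap (HypHom.hV (TGHom.h f)) v))) }
    ; id = λ {A} → record { h = idHyp ; l-comm = (λ e → refl) , (λ v → refl) }
    }

  record EqHypΣObj : Set₁ where
    field
      G : EqHyp
      l : HypHom (EqHyp.H G) (HypΣ Σ')

  record EqHypΣHom (A B : EqHypΣObj) : Set where
    field
      h : EqHypHom (EqHypΣObj.G A) (EqHypΣObj.G B)
      l-comm : SliceComm (EqHypΣObj.l A) (EqHypΣObj.l B) (T-hom h)

  EqHypΣCat : Cat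
  EqHypΣCat = record
    { Obj = EqHypΣObj ; Hom = EqHypΣHom
    ; _≈_ = λ f g → EqHypΣHom.h f ≈EqHyp EqHypΣHom.h g
    ; _∘_ = λ {A} {B} {C} g f → record { h = EqHypΣHom.h g ∘EqHyp EqHypΣHom.h f
        ; l-comm = (λ e → ≡.trans (proj₁ (EqHypΣHom.l-comm f) e)
                     (proj₁ (EqHypΣHom.l-comm g) (ap (HypHom.hE (T-hom (EqHypΣHom.h f))) e)))
                 , (λ v → ≡.trans (proj₂ (EqHypΣHom.l-comm f) v)
                     (proj₂ (EqHypΣHom.l-comm g) (ap (HypHom.hV (T-hom (EqHypΣHom.h f))) v))) }
    ; id = λ {A} → record { h = idEqHyp ; l-comm = (λ e → refl) , (λ v → refl) }
    }

  -- EqTG_Σ : full subcategory of EqHyp_Σ on objects whose label lies in TG_Σ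
  IsTG : EqHypΣObj → Set
  IsTG A = Injective (Hyp.t (EqHyp.H (EqHypΣObj.G A)))

  EqTGObj : Set₁
  EqTGObj = Σ EqHypΣObj IsTG

  EqTGHom : EqTGObj → EqTGObj → Set
  EqTGHom A B = EqHypΣHom (proj₁ A) (proj₁ B)

  EqTGCat : Cat
  EqTGCat = record
    { Obj = EqTGObj ; Hom = EqTGHom
    ; _≈_ = Cat._≈_ EqHypΣCat ; _∘_ = Cat._∘_ EqHypΣCat ; id = Cat.id EqHypΣCat }

  J₀ : EqTGObj → EqHypΣObj
  J₀ = proj₁

  J₁ : {A B : EqTGObj} → EqTGHom A B → EqHypΣHom (J₀ A) (J₀ B)
  J₁ h = h

  S₀ : EqTGObj → TGObj
  S₀ (A , inj) = record { H = EqHyp.H (EqHypΣObj.G A) ; l = EqHypΣObj.l A ; t-inj = inj }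

  S₁ : {A B : EqTGObj} → EqTGHom A B → TGHom (S₀ A) (S₀ B)
  S₁ h = record { h = T-hom (EqHypΣHom.h h) ; l-comm = EqHypΣHom.l-comm h }

  In𝒯 : {A B : EqTGObj} → EqTGHom A B → Set₁
  In𝒯 {A} {B} h = InPb (EqHypΣHom.h h) × IsRegularMono TGCat {S₀ A} {S₀ B} (S₁ {A} {B} h)

  -- J_Σ creates the pushout of the span  B ←f− A −g→ C  (in the sense of
  -- Mac Lane): every pushout of the J-image in EqHyp_Σ has its apex in
  -- EqTG_Σ and (lifted along J) is a pushout in EqTG_Σ.
  JCreatesPushout : {A B C : EqTGObj} → EqTGHom A B → EqTGHom A C → Set₁
  JCreatesPushout {A} {B} {C} f g =
    ∀ (P : EqHypΣObj) (i₁ : EqHypΣHom (J₀ B) P) (i₂ : EqHypΣHom (J₀ C) P) →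
      IsPushout EqHypΣCat (J₁ {A} {B} f) (J₁ {A} {C} g) P i₁ i₂ →
      Σ (IsTG P) λ tgP →
        IsPushout EqTGCat {A} {B} {C} f g (P , tgP) i₁ i₂

{-# OPTIONS --safe #-}

-- A morphism f : A → B in 𝒯 is injective on vertices (regular monos of EqHyp are monos),
-- hence on classes (by the pullback square) and on edges (targets in A are injective).
-- Along such an f the pushout in EqHyp_Σ is computed componentwise, as B ⊎ C glued along A.
-- Its targets stay injective because f is target-closed: testing the regular mono S_Σ(f)
-- against the subgraph on which an equalizing pair agrees shows that an edge of B whose
-- target comes from A itself comes from A, so an edge whose target is glued to C is itself
-- glued to an edge of C. Any other pushout in EqHyp_Σ maps into this one by a comparison map
-- with a retraction, hence injective on edges, so it inherits injective targets; lying in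
-- the full subcategory EqTG_Σ, it is a pushout there as well.

module Submission where

open import Defs
open import Data.Empty using (⊥)
open import Data.Unit using (⊤; tt)
open import Data.List using (List; []; _∷_; map; [_])
open import Data.Product using (Σ; ∃; ∃₂; _×_; _,_; proj₁; proj₂)
open import Data.Sum using (_⊎_; inj₁; inj₂)
open import Data.Sum.Relation.Binary.Pointwise as ⊎ using (⊎-refl; ⊎-symmetric; ⊎-transitive; inj₁; inj₂)
open import Relation.Binary.Bundles using (Setoid)
open import Relation.Binary.Structures using (IsEquivalence)
open import Relation.Binary.PropositionalEquality as ≡ using (_≡_; refl)
import Relation.Binary.Construct.On as On
import Relation.Binary.Reasoning.Setoid as SetoidReasoning
open import Function.Bundles using (Func)
import Data.List.Relation.Binary.Pointwise as PW
open PW using (Pointwise; []; _∷_)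

constM : {S T : Setoid₀} → ∣ T ∣ → Map S T
constM {T = T} c = record { to = λ _ → c ; cong = λ _ → Setoid.refl T }

subsetoid : (S : Setoid₀) (P : ∣ S ∣ → Set) → Setoid₀
subsetoid S P = On.setoid S (proj₁ {B = P})

pullback⇒injective : {A B C D : Setoid₀} {f : Map A B} {g : Map A C} {h : Map B D} {k : Map C D} →
  IsPullbackSq f g h k → Injective f → Surjective g → Injective k
pullback⇒injective {A} {B} {C} {D} {f} {g} {h} {k} (square , universal) f-inj g-surj x y kx≈ky =
  begin
    x              ≈⟨ gv≈x ⟨
    ap g v         ≈⟨ Func.cong g (f-inj v (ap u tt) (Setoid.sym B (proj₁ (proj₂ mediator) tt))) ⟩
    ap g (ap u tt) ≈⟨ proj₁ (proj₂ (proj₂ mediator)) tt ⟩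
    ap g w         ≈⟨ gw≈y ⟩
    y              ∎
  where
  open SetoidReasoning C
  v = proj₁ (g-surj x)
  gv≈x = proj₂ (g-surj x)
  w = proj₁ (g-surj y)
  gw≈y = proj₂ (g-surj y)
  hfv≈kgw : Eq D (ap h (ap f v)) (ap k (ap g w))
  hfv≈kgw = D.trans (square v) (D.trans (Func.cong k gv≈x)
              (D.trans kx≈ky (Func.cong k (Setoid.sym C gw≈y))))
    where module D = Setoid D
  mediator = universal (≡.setoid ⊤) (constM (ap f v)) (constM (ap g w)) (λ _ → hfv≈kgw)
  u = proj₁ mediator

star-resp-≐ : {A B : Setoid₀} {h k : Map A B} → h ≐ k → star h ≐ star k
star-resp-≐ h≐k [] = []
star-resp-≐ {h = h} {k} h≐k (x ∷ w) = h≐k x ∷ star-resp-≐ {h = h} {k} h≐k w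

star-injective : {A B : Setoid₀} {f : Map A B} → Injective f → Injective (star f)
star-injective f-inj [] [] [] = []
star-injective {f = f} f-inj (x ∷ xs) (y ∷ ys) (fx≈fy ∷ fxs≈fys) =
  f-inj x y fx≈fy ∷ star-injective {f = f} f-inj xs ys fxs≈fys

module SetoidPushout {A B C : Setoid₀} (f : Map A B) (g : Map A C) (f-injective : Injective f) where
  private
    module B = Setoid B
    module C = Setoid C

  _LiesOver_ : ∣ B ∣ ⊎ ∣ C ∣ → ∣ A ∣ → Set
  inj₁ b LiesOver a = Eq B b (ap f a)
  inj₂ c LiesOver a = Eq C c (ap g a)

  _≈⊎_ : ∣ B ∣ ⊎ ∣ C ∣ → ∣ B ∣ ⊎ ∣ C ∣ → Set
  _≈⊎_ = ⊎.Pointwise (Eq B) (Eq C)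

  -- No transitive closure is needed: as f is injective, all elements of A that an
  -- element lies over have the same image under g (LiesOver-unique).
  _∼_ : ∣ B ∣ ⊎ ∣ C ∣ → ∣ B ∣ ⊎ ∣ C ∣ → Set
  x ∼ y = x ≈⊎ y ⊎ ∃₂ λ a a' → x LiesOver a × y LiesOver a' × Eq C (ap g a) (ap g a')

  LiesOver-resp : ∀ {x y a} → x ≈⊎ y → y LiesOver a → x LiesOver a
  LiesOver-resp (inj₁ b≈b') b'≈fa = B.trans b≈b' b'≈fa
  LiesOver-resp (inj₂ c≈c') c'≈ga = C.trans c≈c' c'≈ga

  LiesOver-unique : ∀ x {a a'} → x LiesOver a → x LiesOver a' → Eq C (ap g a) (ap g a')
  LiesOver-unique (inj₁ b) {a} {a'} b≈fa b≈fa' = Func.cong g (f-injective a a' (B.trans (B.sym b≈fa) b≈fa'))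
  LiesOver-unique (inj₂ c) c≈ga c≈ga' = C.trans (C.sym c≈ga) c≈ga'

  ∼-isEquivalence : IsEquivalence _∼_
  ∼-isEquivalence = record { refl = inj₁ (⊎-refl B.refl C.refl) ; sym = ∼-sym ; trans = ∼-trans }
    where
    ∼-sym : ∀ {x y} → x ∼ y → y ∼ x
    ∼-sym (inj₁ x≈y) = inj₁ (⊎-symmetric B.sym C.sym x≈y)
    ∼-sym (inj₂ (a , a' , x-over , y-over , ga≈ga')) = inj₂ (a' , a , y-over , x-over , C.sym ga≈ga')

    ∼-trans : ∀ {x y z} → x ∼ y → y ∼ z → x ∼ z
    ∼-trans (inj₁ x≈y) (inj₁ y≈z) = inj₁ (⊎-transitive B.trans C.trans x≈y y≈z)
    ∼-trans (inj₁ x≈y) (inj₂ (a , a' , y-over , z-over , ga≈ga')) =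
      inj₂ (a , a' , LiesOver-resp x≈y y-over , z-over , ga≈ga')
    ∼-trans (inj₂ (a , a' , x-over , y-over , ga≈ga')) (inj₁ y≈z) =
      inj₂ (a , a' , x-over , LiesOver-resp (⊎-symmetric B.sym C.sym y≈z) y-over , ga≈ga')
    ∼-trans {y = y} (inj₂ (a , a' , x-over , y-over , ga≈ga')) (inj₂ (b , b' , y-over' , z-over , gb≈gb')) =
      inj₂ (a , b' , x-over , z-over , C.trans ga≈ga' (C.trans (LiesOver-unique y y-over y-over') gb≈gb'))

  setoid : Setoid₀
  setoid = record { Carrier = ∣ B ∣ ⊎ ∣ C ∣ ; _≈_ = _∼_ ; isEquivalence = ∼-isEquivalence }

  ι₁ : Map B setoid
  ι₁ = record { to = inj₁ ; cong = λ b≈b' → inj₁ (inj₁ b≈b') }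

  ι₂ : Map C setoid
  ι₂ = record { to = inj₂ ; cong = λ c≈c' → inj₁ (inj₂ c≈c') }

  glue : (ι₁ ∘M f) ≐ (ι₂ ∘M g)
  glue a = inj₂ (a , a , B.refl , C.refl , C.refl)

  module _ {X : Setoid₀} (j₁ : Map B X) (j₂ : Map C X) (j-glue : (j₁ ∘M f) ≐ (j₂ ∘M g)) where
    private
      module X = Setoid X

    copair₀ : ∣ B ∣ ⊎ ∣ C ∣ → ∣ X ∣
    copair₀ (inj₁ b) = ap j₁ b
    copair₀ (inj₂ c) = ap j₂ c

    copair₀-over : ∀ x {a} → x LiesOver a → Eq X (copair₀ x) (ap j₂ (ap g a))
    copair₀-over (inj₁ b) {a} b≈fa = X.trans (Func.cong j₁ b≈fa) (j-glue a)
    copair₀-over (inj₂ c) c≈ga = Func.cong j₂ c≈ga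

    copair₀-cong : ∀ {x y} → x ∼ y → Eq X (copair₀ x) (copair₀ y)
    copair₀-cong (inj₁ (inj₁ b≈b')) = Func.cong j₁ b≈b'
    copair₀-cong (inj₁ (inj₂ c≈c')) = Func.cong j₂ c≈c'
    copair₀-cong {x} {y} (inj₂ (a , a' , x-over , y-over , ga≈ga')) =
      X.trans (copair₀-over x x-over) (X.trans (Func.cong j₂ ga≈ga') (X.sym (copair₀-over y y-over)))

    copair : Map setoid X
    copair = record { to = copair₀ ; cong = copair₀-cong }

  copair-unique : {X : Setoid₀} {j₁ : Map B X} {j₂ : Map C X} {j-glue : (j₁ ∘M f) ≐ (j₂ ∘M g)}
    (v : Map setoid X) → (v ∘M ι₁) ≐ j₁ → (v ∘M ι₂) ≐ j₂ → v ≐ copair j₁ j₂ j-glue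
  copair-unique v vι₁≈j₁ vι₂≈j₂ (inj₁ b) = vι₁≈j₁ b
  copair-unique v vι₁≈j₁ vι₂≈j₂ (inj₂ c) = vι₂≈j₂ c

hE-injective : {G H : Hyp} (h : HypHom G H) →
  Injective (Hyp.t G) → Injective (HypHom.hV h) → Injective (HypHom.hE h)
hE-injective {G} {H} h tG-inj hV-inj e e' he≈he' =
  tG-inj e e' (star-injective {f = HypHom.hV h} hV-inj _ _
    (W.trans (HypHom.t-comm h e) (W.trans (Func.cong (Hyp.t H) he≈he') (W.sym (HypHom.t-comm h e')))))
  where module W = Setoid (Words (Hyp.V H))

reflect-t-injective : {G H : Hyp} (h : HypHom G H) →
  Injective (HypHom.hE h) → Injective (Hyp.t H) → Injective (Hyp.t G)
reflect-t-injective {G} {H} h hE-inj tH-inj e e' te≈te' =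
  hE-inj e e' (tH-inj _ _
    (W.trans (W.sym (HypHom.t-comm h e)) (W.trans (Func.cong (star (HypHom.hV h)) te≈te') (HypHom.t-comm h e'))))
  where module W = Setoid (Words (Hyp.V H))

TargetClosed : {A B : Hyp} → HypHom A B → Set
TargetClosed {A} {B} f = ∀ e a →
  Eq (Words (Hyp.V B)) (ap (Hyp.t B) e) [ ap (HypHom.hV f) a ] →
  ∃ λ (a' : ∣ Hyp.E A ∣) → Eq (Hyp.E B) (ap (HypHom.hE f) a') e

target-transfer : {A B C : Hyp} (f : HypHom A B) (g : HypHom A C) → Injective (HypHom.hV f) →
  ∀ a w → Eq (Words (Hyp.V B)) (ap (Hyp.t B) (ap (HypHom.hE f) a)) (ap (star (HypHom.hV f)) w) →
  Eq (Words (Hyp.V C)) (ap (Hyp.t C) (ap (HypHom.hE g) a)) (ap (star (HypHom.hV g)) w)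
target-transfer {A} {B} {C} f g fV-inj a w tfa≈fw =
  Setoid.trans (Words (Hyp.V C)) (Setoid.sym (Words (Hyp.V C)) (HypHom.t-comm g a))
    (Func.cong (star (HypHom.hV g))
      (star-injective {f = HypHom.hV f} fV-inj _ _ (Setoid.trans (Words (Hyp.V B)) (HypHom.t-comm f a) tfa≈fw)))

singleton-of-map : {X : Set} (xs : List X) →
  Pointwise _≡_ (map (λ _ → tt) xs) [ tt ] → ∃ λ x → xs ≡ [ x ]
singleton-of-map [] ()
singleton-of-map (x ∷ []) (_ ∷ []) = x , refl
singleton-of-map (x ∷ y ∷ xs) (_ ∷ ())

module Target {Σ' : Signature} {H : Hyp} (l : HypHom H (HypΣ Σ')) where
  private
    module V = Setoid (Hyp.V H)
    module W = Setoid (Words (Hyp.V H))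

  -- By η for ⊤, HypHom.t-comm l e has the type singleton-of-map expects.
  target : ∣ Hyp.E H ∣ → ∣ Hyp.V H ∣
  target e = proj₁ (singleton-of-map (ap (Hyp.t H) e) (HypHom.t-comm l e))

  t≡[target] : ∀ e → ap (Hyp.t H) e ≡ [ target e ]
  t≡[target] e = proj₂ (singleton-of-map (ap (Hyp.t H) e) (HypHom.t-comm l e))

  t≈[]⇒target≈ : ∀ {e v} → W._≈_ (ap (Hyp.t H) e) [ v ] → V._≈_ (target e) v
  t≈[]⇒target≈ {e} {v} te≈[v] = PW.head (≡.subst (λ w → W._≈_ w [ v ]) (t≡[target] e) te≈[v])

  target≈⇒t≈[] : ∀ {e v} → V._≈_ (target e) v → W._≈_ (ap (Hyp.t H) e) [ v ]
  target≈⇒t≈[] {e} {v} target≈v =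
    ≡.subst (λ w → W._≈_ w [ v ]) (≡.sym (t≡[target] e)) (target≈v ∷ [])

  target-injective : Injective (Hyp.t H) → ∀ {e e'} → V._≈_ (target e) (target e') → Eq (Hyp.E H) e e'
  target-injective t-inj {e} {e'} target≈target' =
    t-inj e e' (W.trans (target≈⇒t≈[] target≈target') (W.reflexive (≡.sym (t≡[target] e'))))

≈EqHyp-refl : {G H : EqHyp} (h : EqHypHom G H) → h ≈EqHyp h
≈EqHyp-refl {H = H} h =
  ((λ _ → Setoid.refl (Hyp.E (EqHyp.H H))) , (λ _ → Setoid.refl (Hyp.V (EqHyp.H H)))) ,
  (λ _ → Setoid.refl (EqHyp.Q H))

≈EqHyp-sym : {G H : EqHyp} {h k : EqHypHom G H} → h ≈EqHyp k → k ≈EqHyp h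
≈EqHyp-sym {H = H} ((hE≈kE , hV≈kV) , hQ≈kQ) =
  ((λ e → Setoid.sym (Hyp.E (EqHyp.H H)) (hE≈kE e)) , (λ v → Setoid.sym (Hyp.V (EqHyp.H H)) (hV≈kV v))) ,
  (λ c → Setoid.sym (EqHyp.Q H) (hQ≈kQ c))

≈EqHyp-trans : {G H : EqHyp} {h k m : EqHypHom G H} → h ≈EqHyp k → k ≈EqHyp m → h ≈EqHyp m
≈EqHyp-trans {H = H} ((hE≈kE , hV≈kV) , hQ≈kQ) ((kE≈mE , kV≈mV) , kQ≈mQ) =
  ((λ e → Setoid.trans (Hyp.E (EqHyp.H H)) (hE≈kE e) (kE≈mE e)) ,
   (λ v → Setoid.trans (Hyp.V (EqHyp.H H)) (hV≈kV v) (kV≈mV v))) ,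
  (λ c → Setoid.trans (EqHyp.Q H) (hQ≈kQ c) (kQ≈mQ c))

regularMono⇒mono : {X G H : EqHyp} (h : EqHypHom G H) → IsRegularMono EqHypCat h →
  (x y : EqHypHom X G) → (h ∘EqHyp x) ≈EqHyp (h ∘EqHyp y) → x ≈EqHyp y
regularMono⇒mono {X} {G} {H} h (K , p , r , ((ph≈rh-E , ph≈rh-V) , ph≈rh-Q) , universal) x y hx≈hy =
  ≈EqHyp-trans {h = x} {u} {y} x≈u (≈EqHyp-sym {h = y} {u} y≈u)
  where
  xT = T-hom x
  equalized : (p ∘EqHyp (h ∘EqHyp x)) ≈EqHyp (r ∘EqHyp (h ∘EqHyp x))
  equalized = ((λ e → ph≈rh-E (ap (HypHom.hE xT) e)) , (λ v → ph≈rh-V (ap (HypHom.hV xT) v))) ,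
              (λ c → ph≈rh-Q (ap (EqHypHom.hQ x) c))
  mediator = universal X (h ∘EqHyp x) equalized
  u = proj₁ mediator
  unique = proj₂ (proj₂ mediator)
  x≈u = unique x (≈EqHyp-refl (h ∘EqHyp x))
  y≈u = unique y (≈EqHyp-sym {h = h ∘EqHyp x} {h ∘EqHyp y} hx≈hy)

fromEmpty : {S : Setoid₀} → Map (≡.setoid ⊥) S
fromEmpty = record { to = λ () ; cong = λ { {()} } }

pointEqHyp : EqHyp
pointEqHyp = record
  { H = record { E = ≡.setoid ⊥ ; V = ≡.setoid ⊤ ; s = fromEmpty ; t = fromEmpty }
  ; Q = ≡.setoid ⊤ ; q = idM ; q-surj = λ c → c , refl }

vertexAt : (G : EqHyp) → ∣ Hyp.V (EqHyp.H G) ∣ → EqHypHom pointEqHyp G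
vertexAt G v = record
  { T-hom = record { hE = fromEmpty ; hV = constM v
                   ; s-comm = λ () ; t-comm = λ () }
  ; hQ = constM (ap (EqHyp.q G) v) ; q-comm = λ _ → Setoid.refl (EqHyp.Q G) }

regularMono⇒hV-injective : {G H : EqHyp} (h : EqHypHom G H) → IsRegularMono EqHypCat h →
  Injective (HypHom.hV (T-hom h))
regularMono⇒hV-injective {G} {H} h regular v w hv≈hw =
  proj₂ (proj₁ (regularMono⇒mono h regular (vertexAt G v) (vertexAt G w) same-image)) tt
  where
  module QH = Setoid (EqHyp.Q H)
  same-image : (h ∘EqHyp vertexAt G v) ≈EqHyp (h ∘EqHyp vertexAt G w)
  same-image = ((λ ()) , (λ _ → hv≈hw)) ,
    (λ _ → QH.trans (EqHypHom.q-comm h v)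
             (QH.trans (Func.cong (EqHyp.q H) hv≈hw) (QH.sym (EqHypHom.q-comm h w))))

Pb⇒injective : {G H : EqHyp} (h : EqHypHom G H) → InPb h →
  Injective (HypHom.hV (T-hom h)) × Injective (EqHypHom.hQ h)
Pb⇒injective {G} {H} h (regular , pullback) =
  hV-injective ,
  pullback⇒injective {f = HypHom.hV (T-hom h)} {EqHyp.q G} {EqHyp.q H} {EqHypHom.hQ h}
    pullback hV-injective (EqHyp.q-surj G)
  where hV-injective = regularMono⇒hV-injective h regular

module EqualizerSubgraph {Σ' : Signature} {B K : TGObj Σ'} (p r : TGHom Σ' B K) where
  private
    HB = TGObj.H B
    HK = TGObj.H K
    VB = Hyp.V HB
    VK = Hyp.V HK
    pT = TGHom.h p
    rT = TGHom.h r
    pV = HypHom.hV pT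
    rV = HypHom.hV rT
    pE = HypHom.hE pT
    rE = HypHom.hE rT
    module WK = Setoid (Words VK)

  vertices : Setoid₀
  vertices = subsetoid VB λ v → Eq VK (ap pV v) (ap rV v)

  edges : Setoid₀
  edges = subsetoid (Hyp.E HB) λ e → Eq (Hyp.E HK) (ap pE e) (ap rE e)

  liftWord : (vs : List ∣ VB ∣) → Pointwise (Eq VK) (map (ap pV) vs) (map (ap rV) vs) → List ∣ vertices ∣
  liftWord [] [] = []
  liftWord (v ∷ vs) (pv≈rv ∷ agree) = (v , pv≈rv) ∷ liftWord vs agree

  map-proj₁-liftWord : ∀ vs agree → map proj₁ (liftWord vs agree) ≡ vs
  map-proj₁-liftWord [] [] = refl
  map-proj₁-liftWord (v ∷ vs) (_ ∷ agree) = ≡.cong (v ∷_) (map-proj₁-liftWord vs agree)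

  liftWord-cong : ∀ {vs ws} → Pointwise (Eq VB) vs ws →
    ∀ agree agree' → Pointwise (Eq vertices) (liftWord vs agree) (liftWord ws agree')
  liftWord-cong [] [] [] = []
  liftWord-cong (v≈w ∷ vs≈ws) (_ ∷ agree) (_ ∷ agree') = v≈w ∷ liftWord-cong vs≈ws agree agree'

  liftAttachment : (σB : Map (Hyp.E HB) (Words VB)) (σK : Map (Hyp.E HK) (Words VK)) →
    (star pV ∘M σB) ≐ (σK ∘M pE) → (star rV ∘M σB) ≐ (σK ∘M rE) → Map edges (Words vertices)
  liftAttachment σB σK σp σr = record
    { to = λ x → liftWord (ap σB (proj₁ x)) (letters-agree (proj₁ x) (proj₂ x))
    ; cong = λ x≈y → liftWord-cong (Func.cong σB x≈y) _ _ }
    where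
    letters-agree : ∀ e → Eq (Hyp.E HK) (ap pE e) (ap rE e) →
      Pointwise (Eq VK) (map (ap pV) (ap σB e)) (map (ap rV) (ap σB e))
    letters-agree e pe≈re = WK.trans (σp e) (WK.trans (Func.cong σK pe≈re) (WK.sym (σr e)))

  subgraph₀ : Hyp
  subgraph₀ = record
    { E = edges ; V = vertices
    ; s = liftAttachment (Hyp.s HB) (Hyp.s HK) (HypHom.s-comm pT) (HypHom.s-comm rT)
    ; t = liftAttachment (Hyp.t HB) (Hyp.t HK) (HypHom.t-comm pT) (HypHom.t-comm rT) }

  inclusion₀ : HypHom subgraph₀ HB
  inclusion₀ = record
    { hE = record { to = proj₁ ; cong = λ e≈e' → e≈e' }
    ; hV = record { to = proj₁ ; cong = λ v≈v' → v≈v' }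
    ; s-comm = λ _ → Setoid.reflexive (Words VB) (map-proj₁-liftWord _ _)
    ; t-comm = λ _ → Setoid.reflexive (Words VB) (map-proj₁-liftWord _ _) }

  subgraph : TGObj Σ'
  subgraph = record
    { H = subgraph₀ ; l = TGObj.l B ∘Hyp inclusion₀
    ; t-inj = reflect-t-injective inclusion₀ (λ _ _ e≈e' → e≈e') (TGObj.t-inj B) }

  inclusion : TGHom Σ' subgraph B
  inclusion = record { h = inclusion₀ ; l-comm = (λ _ → refl) , (λ _ → refl) }

  inclusion-equalizes : Cat._≈_ (TGCat Σ') (Cat._∘_ (TGCat Σ') p inclusion) (Cat._∘_ (TGCat Σ') r inclusion)
  inclusion-equalizes = proj₂ , proj₂

regularMono⇒targetClosed : {Σ' : Signature} {A B : TGObj Σ'} (h : TGHom Σ' A B) →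
  IsRegularMono (TGCat Σ') h → TargetClosed (TGHom.h h)
regularMono⇒targetClosed {Σ'} {A} {B} h (K , p , r , (_ , ph≈rh-V) , universal) e a te≈[ha] =
  ap (HypHom.hE (TGHom.h u)) (e , pe≈re) , proj₁ hu≈inclusion (e , pe≈re)
  where
  open EqualizerSubgraph p r
  HB = TGObj.H B
  HK = TGObj.H K
  pT = TGHom.h p
  rT = TGHom.h r
  pe≈re : Eq (Hyp.E HK) (ap (HypHom.hE pT) e) (ap (HypHom.hE rT) e)
  pe≈re = TGObj.t-inj K _ _ (begin
    ap (Hyp.t HK) (ap (HypHom.hE pT) e)        ≈⟨ HypHom.t-comm pT e ⟨
    ap (star (HypHom.hV pT)) (ap (Hyp.t HB) e) ≈⟨ Func.cong (star (HypHom.hV pT)) te≈[ha] ⟩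
    [ ap (HypHom.hV pT) (ap (HypHom.hV (TGHom.h h)) a) ] ≈⟨ ph≈rh-V a ∷ [] ⟩
    [ ap (HypHom.hV rT) (ap (HypHom.hV (TGHom.h h)) a) ] ≈⟨ Func.cong (star (HypHom.hV rT)) te≈[ha] ⟨
    ap (star (HypHom.hV rT)) (ap (Hyp.t HB) e) ≈⟨ HypHom.t-comm rT e ⟩
    ap (Hyp.t HK) (ap (HypHom.hE rT) e)        ∎)
    where open SetoidReasoning (Words (Hyp.V HK))
  mediator = universal subgraph inclusion inclusion-equalizes
  u = proj₁ mediator
  hu≈inclusion = proj₁ (proj₂ mediator)

module HypPushout {A B C : Hyp} (f : HypHom A B) (g : HypHom A C)
  (fE-injective : Injective (HypHom.hE f)) (fV-injective : Injective (HypHom.hV f)) where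
  private
    fE = HypHom.hE f
    fV = HypHom.hV f
    gE = HypHom.hE g
    gV = HypHom.hV g

  module PE = SetoidPushout fE gE fE-injective
  module PV = SetoidPushout fV gV fV-injective

  wordsCopair : (σA : Map (Hyp.E A) (Words (Hyp.V A))) (σB : Map (Hyp.E B) (Words (Hyp.V B)))
    (σC : Map (Hyp.E C) (Words (Hyp.V C))) →
    (star fV ∘M σA) ≐ (σB ∘M fE) → (star gV ∘M σA) ≐ (σC ∘M gE) → Map PE.setoid (Words PV.setoid)
  wordsCopair σA σB σC σf σg = PE.copair (star PV.ι₁ ∘M σB) (star PV.ι₂ ∘M σC) glued
    where
    open SetoidReasoning (Words PV.setoid)
    glued : ((star PV.ι₁ ∘M σB) ∘M fE) ≐ ((star PV.ι₂ ∘M σC) ∘M gE)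
    glued a = begin
      ap (star PV.ι₁) (ap σB (ap fE a))           ≈⟨ Func.cong (star PV.ι₁) (σf a) ⟨
      ap (star PV.ι₁) (ap (star fV) (ap σA a))    ≈⟨ star-∘ PV.ι₁ fV (ap σA a) ⟨
      ap (star (PV.ι₁ ∘M fV)) (ap σA a)           ≈⟨ star-resp-≐ {h = PV.ι₁ ∘M fV} {PV.ι₂ ∘M gV} PV.glue _ ⟩
      ap (star (PV.ι₂ ∘M gV)) (ap σA a)           ≈⟨ star-∘ PV.ι₂ gV (ap σA a) ⟩
      ap (star PV.ι₂) (ap (star gV) (ap σA a))    ≈⟨ Func.cong (star PV.ι₂) (σg a) ⟩
      ap (star PV.ι₂) (ap σC (ap gE a))           ∎

  apex : Hyp
  apex = record
    { E = PE.setoid ; V = PV.setoid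
    ; s = wordsCopair (Hyp.s A) (Hyp.s B) (Hyp.s C) (HypHom.s-comm f) (HypHom.s-comm g)
    ; t = wordsCopair (Hyp.t A) (Hyp.t B) (Hyp.t C) (HypHom.t-comm f) (HypHom.t-comm g) }

  ι₁ : HypHom B apex
  ι₁ = record { hE = PE.ι₁ ; hV = PV.ι₁
              ; s-comm = λ _ → Setoid.refl (Words PV.setoid) ; t-comm = λ _ → Setoid.refl (Words PV.setoid) }

  ι₂ : HypHom C apex
  ι₂ = record { hE = PE.ι₂ ; hV = PV.ι₂
              ; s-comm = λ _ → Setoid.refl (Words PV.setoid) ; t-comm = λ _ → Setoid.refl (Words PV.setoid) }

  copair : {X : Hyp} (j₁ : HypHom B X) (j₂ : HypHom C X) → (j₁ ∘Hyp f) ≈Hyp (j₂ ∘Hyp g) → HypHom apex X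
  copair {X} j₁ j₂ (j-glue-E , j-glue-V) = record
    { hE = PE.copair (HypHom.hE j₁) (HypHom.hE j₂) j-glue-E
    ; hV = uV
    ; s-comm = λ { (inj₁ e) → W.trans (unfold PV.ι₁ _) (HypHom.s-comm j₁ e)
                 ; (inj₂ e) → W.trans (unfold PV.ι₂ _) (HypHom.s-comm j₂ e) }
    ; t-comm = λ { (inj₁ e) → W.trans (unfold PV.ι₁ _) (HypHom.t-comm j₁ e)
                 ; (inj₂ e) → W.trans (unfold PV.ι₂ _) (HypHom.t-comm j₂ e) } }
    where
    module W = Setoid (Words (Hyp.V X))
    uV = PV.copair (HypHom.hV j₁) (HypHom.hV j₂) j-glue-V
    unfold : {Y : Setoid₀} (ι : Map Y PV.setoid) (w : ∣ Words Y ∣) →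
      W._≈_ (ap (star uV) (ap (star ι) w)) (ap (star (uV ∘M ι)) w)
    unfold ι w = W.sym (star-∘ uV ι w)

  copair-unique : {X : Hyp} {j₁ : HypHom B X} {j₂ : HypHom C X} {j-glue : (j₁ ∘Hyp f) ≈Hyp (j₂ ∘Hyp g)}
    (v : HypHom apex X) → (v ∘Hyp ι₁) ≈Hyp j₁ → (v ∘Hyp ι₂) ≈Hyp j₂ →
    v ≈Hyp copair j₁ j₂ j-glue
  copair-unique {j-glue = j-glue} v (vι₁≈j₁-E , vι₁≈j₁-V) (vι₂≈j₂-E , vι₂≈j₂-V) =
    PE.copair-unique {j-glue = proj₁ j-glue} (HypHom.hE v) vι₁≈j₁-E vι₂≈j₂-E ,
    PV.copair-unique {j-glue = proj₂ j-glue} (HypHom.hV v) vι₁≈j₁-V vι₂≈j₂-V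

  module _ {Σ' : Signature} (lB : HypHom B (HypΣ Σ')) (lC : HypHom C (HypΣ Σ'))
    (tB-injective : Injective (Hyp.t B)) (tC-injective : Injective (Hyp.t C))
    (f-closed : TargetClosed f) where
    private
      module TB = Target lB
      module TC = Target lC
      module EC = Setoid (Hyp.E C)
      module VC = Setoid (Hyp.V C)
      module PEₛ = Setoid PE.setoid

    apexTarget : ∣ PE.setoid ∣ → ∣ PV.setoid ∣
    apexTarget (inj₁ e) = inj₁ (TB.target e)
    apexTarget (inj₂ e) = inj₂ (TC.target e)

    t≡[apexTarget] : ∀ x → ap (Hyp.t apex) x ≡ [ apexTarget x ]
    t≡[apexTarget] (inj₁ e) = ≡.cong (map inj₁) (TB.t≡[target] e)
    t≡[apexTarget] (inj₂ e) = ≡.cong (map inj₂) (TC.t≡[target] e)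

    glued-into-C : ∀ x a → apexTarget x PV.LiesOver a →
      ∃ λ (c : ∣ Hyp.E C ∣) → x PE.∼ inj₂ c × VC._≈_ (TC.target c) (ap gV a)
    glued-into-C (inj₂ c) a target≈ga = c , PEₛ.refl , target≈ga
    glued-into-C (inj₁ e) a target≈fa =
      ap gE a' , inj₂ (a' , a' , Setoid.sym (Hyp.E B) fa'≈e , EC.refl , EC.refl) ,
      TC.t≈[]⇒target≈ (target-transfer f g fV-injective a' [ a ]
        (Setoid.trans (Words (Hyp.V B)) (Func.cong (Hyp.t B) fa'≈e) te≈[fa]))
      where
      te≈[fa] = TB.target≈⇒t≈[] target≈fa
      a' = proj₁ (f-closed e a te≈[fa])
      fa'≈e = proj₂ (f-closed e a te≈[fa])

    apexTarget-injective : ∀ x y → apexTarget x PV.∼ apexTarget y → x PE.∼ y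
    apexTarget-injective (inj₁ _) (inj₁ _) (inj₁ (inj₁ te≈te')) =
      inj₁ (inj₁ (TB.target-injective tB-injective te≈te'))
    apexTarget-injective (inj₂ _) (inj₂ _) (inj₁ (inj₂ tc≈tc')) =
      inj₁ (inj₂ (TC.target-injective tC-injective tc≈tc'))
    apexTarget-injective (inj₁ _) (inj₂ _) (inj₁ ())
    apexTarget-injective (inj₂ _) (inj₁ _) (inj₁ ())
    apexTarget-injective x y (inj₂ (a , a' , x-over , y-over , ga≈ga')) =
      PEₛ.trans x∼c (PEₛ.trans (inj₁ (inj₂ c≈c')) (PEₛ.sym y∼c'))
      where
      x-glued = glued-into-C x a x-over
      y-glued = glued-into-C y a' y-over
      x∼c = proj₁ (proj₂ x-glued)
      y∼c' = proj₁ (proj₂ y-glued)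
      c≈c' : EC._≈_ (proj₁ x-glued) (proj₁ y-glued)
      c≈c' = TC.target-injective tC-injective
        (VC.trans (proj₂ (proj₂ x-glued)) (VC.trans ga≈ga' (VC.sym (proj₂ (proj₂ y-glued)))))

    apex-t-injective : Injective (Hyp.t apex)
    apex-t-injective x y tx≈ty = apexTarget-injective x y
      (PW.head (≡.subst₂ (Pointwise PV._∼_) (t≡[apexTarget] x) (t≡[apexTarget] y) tx≈ty))

module EqHypΣPushout {Σ' : Signature} {A B C : EqHypΣObj Σ'} (f : EqHypΣHom Σ' A B) (g : EqHypΣHom Σ' A C)
  (fE-injective : Injective (HypHom.hE (T-hom (EqHypΣHom.h f))))
  (fV-injective : Injective (HypHom.hV (T-hom (EqHypΣHom.h f))))
  (fQ-injective : Injective (EqHypHom.hQ (EqHypΣHom.h f))) where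
  private
    GA = EqHypΣObj.G A
    GB = EqHypΣObj.G B
    GC = EqHypΣObj.G C
    fh = EqHypΣHom.h f
    gh = EqHypΣHom.h g
    module QB = Setoid (EqHyp.Q GB)
    module QC = Setoid (EqHyp.Q GC)

  module HP = HypPushout (T-hom fh) (T-hom gh) fE-injective fV-injective
  module PQ = SetoidPushout (EqHypHom.hQ fh) (EqHypHom.hQ gh) fQ-injective

  quotient : Map HP.PV.setoid PQ.setoid
  quotient = HP.PV.copair (PQ.ι₁ ∘M EqHyp.q GB) (PQ.ι₂ ∘M EqHyp.q GC) λ a →
    inj₂ (ap (EqHyp.q GA) a , ap (EqHyp.q GA) a ,
          QB.sym (EqHypHom.q-comm fh a) , QC.sym (EqHypHom.q-comm gh a) , QC.refl)

  quotient-surjective : Surjective quotient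
  quotient-surjective (inj₁ c) = inj₁ (proj₁ (EqHyp.q-surj GB c)) , inj₁ (inj₁ (proj₂ (EqHyp.q-surj GB c)))
  quotient-surjective (inj₂ c) = inj₂ (proj₁ (EqHyp.q-surj GC c)) , inj₁ (inj₂ (proj₂ (EqHyp.q-surj GC c)))

  label : HypHom HP.apex (HypΣ Σ')
  label = HP.copair (EqHypΣObj.l B) (EqHypΣObj.l C)
    ((λ a → ≡.trans (≡.sym (proj₁ (EqHypΣHom.l-comm f) a)) (proj₁ (EqHypΣHom.l-comm g) a)) ,
     (λ _ → refl))

  apex : EqHypΣObj Σ'
  apex = record { G = record { H = HP.apex ; Q = PQ.setoid ; q = quotient ; q-surj = quotient-surjective }
                ; l = label }

  ι₁ : EqHypΣHom Σ' B apex
  ι₁ = record { h = record { T-hom = HP.ι₁ ; hQ = PQ.ι₁ ; q-comm = λ _ → Setoid.refl PQ.setoid }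
              ; l-comm = (λ _ → refl) , (λ _ → refl) }

  ι₂ : EqHypΣHom Σ' C apex
  ι₂ = record { h = record { T-hom = HP.ι₂ ; hQ = PQ.ι₂ ; q-comm = λ _ → Setoid.refl PQ.setoid }
              ; l-comm = (λ _ → refl) , (λ _ → refl) }

  mediator : {X : EqHypΣObj Σ'} (j₁ : EqHypΣHom Σ' B X) (j₂ : EqHypΣHom Σ' C X) →
    Cat._≈_ (EqHypΣCat Σ') (Cat._∘_ (EqHypΣCat Σ') j₁ f) (Cat._∘_ (EqHypΣCat Σ') j₂ g) →
    EqHypΣHom Σ' apex X
  mediator j₁ j₂ (j-glue-H , j-glue-Q) = record
    { h = record
      { T-hom = HP.copair (T-hom j₁h) (T-hom j₂h) j-glue-H
      ; hQ = PQ.copair (EqHypHom.hQ j₁h) (EqHypHom.hQ j₂h) j-glue-Q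
      ; q-comm = λ { (inj₁ v) → EqHypHom.q-comm j₁h v ; (inj₂ v) → EqHypHom.q-comm j₂h v } }
    ; l-comm = (λ { (inj₁ e) → proj₁ (EqHypΣHom.l-comm j₁) e
                  ; (inj₂ e) → proj₁ (EqHypΣHom.l-comm j₂) e })
             , (λ _ → refl) }
    where
    j₁h = EqHypΣHom.h j₁
    j₂h = EqHypΣHom.h j₂

  isPushout : IsPushout (EqHypΣCat Σ') f g apex ι₁ ι₂
  isPushout = ((HP.PE.glue , HP.PV.glue) , PQ.glue) , λ X j₁ j₂ j-glue →
    mediator j₁ j₂ j-glue , ≈EqHyp-refl (EqHypΣHom.h j₁) , ≈EqHyp-refl (EqHypΣHom.h j₂) ,
    λ v (vι₁≈j₁-H , vι₁≈j₁-Q) (vι₂≈j₂-H , vι₂≈j₂-Q) →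
      HP.copair-unique {j₁ = T-hom (EqHypΣHom.h j₁)} {T-hom (EqHypΣHom.h j₂)} {proj₁ j-glue}
        (T-hom (EqHypΣHom.h v)) vι₁≈j₁-H vι₂≈j₂-H ,
      PQ.copair-unique {j-glue = proj₂ j-glue} (EqHypHom.hQ (EqHypΣHom.h v)) vι₁≈j₁-Q vι₂≈j₂-Q

pushout-comparison-hE-injective : {Σ' : Signature} {A B C P P' : EqHypΣObj Σ'}
  {f : EqHypΣHom Σ' A B} {g : EqHypΣHom Σ' A C} {i₁ : EqHypΣHom Σ' B P} {i₂ : EqHypΣHom Σ' C P}
  {i₁' : EqHypΣHom Σ' B P'} {i₂' : EqHypΣHom Σ' C P'} →
  IsPushout (EqHypΣCat Σ') f g P i₁ i₂ → IsPushout (EqHypΣCat Σ') f g P' i₁' i₂' →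
  Σ (EqHypΣHom Σ' P P') λ u → Injective (HypHom.hE (T-hom (EqHypΣHom.h u)))
pushout-comparison-hE-injective {Σ'} {P = P} {P'} {i₁ = i₁} {i₂} {i₁'} {i₂'}
  (square , universal) (square' , universal') =
  u , λ e e' ue≈ue' → EP.trans (EP.sym (wu≈id e)) (EP.trans (Func.cong wE ue≈ue') (wu≈id e'))
  where
  open Cat (EqHypΣCat Σ') using (_∘_; _≈_; id)
  module EP = Setoid (Hyp.E (EqHyp.H (EqHypΣObj.G P)))
  module VP = Setoid (Hyp.V (EqHyp.H (EqHypΣObj.G P)))
  module QP = Setoid (EqHyp.Q (EqHypΣObj.G P))
  to-P' = universal P' i₁' i₂' square'
  to-P = universal' P i₁ i₂ square
  u = proj₁ to-P'
  w = proj₁ to-P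
  wE = HypHom.hE (T-hom (EqHypΣHom.h w))
  wV = HypHom.hV (T-hom (EqHypΣHom.h w))
  wQ = EqHypHom.hQ (EqHypΣHom.h w)
  unique-endo = proj₂ (proj₂ (proj₂ (universal P i₁ i₂ square)))

  through : ∀ {Z} {i : EqHypΣHom Σ' Z P} {i' : EqHypΣHom Σ' Z P'} →
    (u ∘ i) ≈ i' → (w ∘ i') ≈ i → ((w ∘ u) ∘ i) ≈ i
  through ((ui-E , ui-V) , ui-Q) ((wi'-E , wi'-V) , wi'-Q) =
    ((λ x → EP.trans (Func.cong wE (ui-E x)) (wi'-E x)) , (λ x → VP.trans (Func.cong wV (ui-V x)) (wi'-V x))) ,
    (λ x → QP.trans (Func.cong wQ (ui-Q x)) (wi'-Q x))

  wu≈id : ∀ e → EP._≈_ (ap wE (ap (HypHom.hE (T-hom (EqHypΣHom.h u))) e)) e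
  wu≈id e = EP.trans (proj₁ (proj₁ wu≈mediator) e) (EP.sym (proj₁ (proj₁ id≈mediator) e))
    where
    wu≈mediator = unique-endo (w ∘ u)
      (through {i = i₁} {i₁'} (proj₁ (proj₂ to-P')) (proj₁ (proj₂ to-P)))
      (through {i = i₂} {i₂'} (proj₁ (proj₂ (proj₂ to-P'))) (proj₁ (proj₂ (proj₂ to-P))))
    id≈mediator = unique-endo id (≈EqHyp-refl (EqHypΣHom.h i₁)) (≈EqHyp-refl (EqHypΣHom.h i₂))

proposition4p24 : (Σ' : Signature) {A B C : EqTGObj Σ'}
    (f : EqTGHom Σ' A B) (g : EqTGHom Σ' A C) → In𝒯 Σ' {A} {B} f →
    HasPushout (EqTGCat Σ') {A} {B} {C} f g × JCreatesPushout Σ' {A} {B} {C} f g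
proposition4p24 Σ' {A} {B} {C} f g (f∈Pb , S₁f-regular) = hasPushout , creates
  where
  fh = EqHypΣHom.h f
  fV-injective = proj₁ (Pb⇒injective fh f∈Pb)
  fQ-injective = proj₂ (Pb⇒injective fh f∈Pb)
  fE-injective = hE-injective (T-hom fh) (proj₂ A) fV-injective
  open EqHypΣPushout f g fE-injective fV-injective fQ-injective

  in-EqTG : ∀ P i₁ i₂ → IsPushout (EqHypΣCat Σ') f g P i₁ i₂ → (P-isTG : IsTG Σ' P) →
    IsPushout (EqTGCat Σ') {A} {B} {C} f g (P , P-isTG) i₁ i₂
  in-EqTG _ _ _ (square , universal) _ = square , λ X → universal (proj₁ X)

  apex-isTG : IsTG Σ' apex
  apex-isTG = HP.apex-t-injective (EqHypΣObj.l (proj₁ B)) (EqHypΣObj.l (proj₁ C)) (proj₂ B) (proj₂ C)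
    (regularMono⇒targetClosed (S₁ Σ' {A} {B} f) S₁f-regular)

  hasPushout : HasPushout (EqTGCat Σ') {A} {B} {C} f g
  hasPushout = (apex , apex-isTG) , ι₁ , ι₂ , in-EqTG apex ι₁ ι₂ isPushout apex-isTG

  creates : JCreatesPushout Σ' {A} {B} {C} f g
  creates P i₁ i₂ P-pushout = P-isTG , in-EqTG P i₁ i₂ P-pushout P-isTG
    where
    comparison = pushout-comparison-hE-injective {f = f} {g} {i₁} {i₂} {ι₁} {ι₂} P-pushout isPushout
    P-isTG = reflect-t-injective (T-hom (EqHypΣHom.h (proj₁ comparison))) (proj₂ comparison) apex-isTG
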